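{- Let $\mathbf{n}=(n_1,\ldots,n_d)$ be a tuple of positive integers, let $\rho\in[d]$, and let $\gamma=(\gamma_{a,b,c})_{a,b\in[d],\,c\in[n_b]}$ be a tuple of non-negative integers. Let $s,t\in[d]$ and $i\neq j\in[n_t]$, and let $\gamma'$ be defined by $\gamma'_{s,t,i}=\gamma_{s,t,i}-1$, $\gamma'_{s,t,j}=\gamma_{s,t,j}+1$, and $\gamma'_{a,b,c}=\gamma_{a,b,c}$ for $(a,b,c)\notin\{(s,t,i),(s,t,j)\}$. Then $$\gamma_{s,t,i}\,|\mathcal{T}_{\rho,\gamma}|=\gamma'_{s,t,j}\,|\mathcal{T}_{\rho,\gamma'}|.$$
   Context: A multitype Cayley tree of profile $\mathbf{n}$ is a tree with vertex set $\{(t,i): t\in[d],\ i\in[n_t]\}$, the vertex $(t,i)$ having type $t$ and label $i$. $\mathcal{T}_\rho(\mathbf{n})$ is the set of such trees with a distinguished root vertex of type $\rho$, edges oriented toward the root. For $T\in\mathcal{T}_\rho(\mathbf{n})$, $\mathrm{ch}_s(t,i)$ is the number of children of type $s$ of $(t,i)$. For a tuple $\beta=(\beta_{s,t,i})_{s,t\in[d],i\in[n_t]}$ of integers, $\mathcal{T}_{\rho,\beta}$ is the set of $T\in\mathcal{T}_\rho(\mathbf{n})$ with $\mathrm{ch}_s(t,i)=\beta_{s,t,i}$ for all $s,t\in[d]$, $i\in[n_t]$ (empty if some entry is negative). -}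

module Defs where

open import Data.Nat using (ℕ; zero; suc)
open import Data.Integer using (ℤ; +_; _+_; _-_)
open import Data.Fin using (Fin) renaming (_≟_ to _≟F_)
open import Data.Fin.Properties using ()
open import Data.List using (List; []; _∷_; [_]; map; concatMap; filter; length; allFin)
open import Data.Maybe using (Maybe; nothing; just)
import Data.Maybe.Properties as MP
import Data.Product.Properties as PP
open import Data.Product using (Σ; Σ-syntax; ∃; ∃-syntax; _×_; _,_; proj₁)
open import Data.Bool using (if_then_else_)
open import Relation.Nullary using (¬_; Dec; yes; no; ⌊_⌋)
open import Relation.Nullary.Decidable using (_×-dec_)
open import Relation.Binary.PropositionalEquality using (_≡_)
open import Relation.Binary.Definitions using (DecidableEquality)

-- Vertex set of a multitype Cayley tree of profile n : vertices (t , i),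
-- t ∈ [d] the type, i ∈ [n t] the label (0-based Fin indexing).
Vtx : (d : ℕ) → (Fin d → ℕ) → Set
Vtx d n = Σ (Fin d) (λ t → Fin (n t))

_≟V_ : ∀ {d n} → DecidableEquality (Vtx d n)
_≟V_ = PP.≡-dec _≟F_ _≟F_

vertices : (d : ℕ) (n : Fin d → ℕ) → List (Vtx d n)
vertices d n = concatMap (λ t → map (λ i → (t , i)) (allFin (n t))) (allFin d)

-- A tree oriented toward its root is encoded by its parent map:
-- par v = just w  iff  (v → w) is an edge (w is the parent of v);
-- par v = nothing iff v is the root.
Par : (d : ℕ) (n : Fin d → ℕ) → Set
Par d n = Vtx d n → Maybe (Vtx d n)

iter : ∀ {d n} → Par d n → ℕ → Maybe (Vtx d n) → Maybe (Vtx d n)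
iter par zero    x        = x
iter par (suc k) nothing  = nothing
iter par (suc k) (just v) = iter par k (par v)

-- par encodes a tree on the full vertex set, rooted at a vertex of type ρ:
-- there is a unique vertex without parent, it has type ρ, and from every
-- vertex, following parent pointers eventually ends at the root
-- (so no cycles; n - 1 edges, connected: a tree oriented toward the root).
IsRootedTree : ∀ {d n} → Fin d → Par d n → Set
IsRootedTree {d} {n} ρ par =
  Σ[ r ∈ Fin (n ρ) ]
    (par (ρ , r) ≡ nothing)
  × (∀ v → par v ≡ nothing → v ≡ (ρ , r))
  × (∀ v → ∃[ k ] iter par k (just v) ≡ nothing)

ch : ∀ {d n} → Par d n → Fin d → Vtx d n → ℕ
ch {d} {n} par s v =
  length (filter (λ u → (proj₁ u ≟F s) ×-dec MP.≡-dec _≟V_ (par u) (just v)) (vertices d n))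

-- Membership in T_{ρ,β}, with β integer valued (β s (t , i) = β_{s,t,i}).
InT : ∀ {d n} → Fin d → (Fin d → Vtx d n → ℤ) → Par d n → Set
InT ρ β par = IsRootedTree ρ par × (∀ s v → + ch par s v ≡ β s v)

-- Enumeration of all functions A → B (A given by a duplicate-free list xs
-- covering A, B by the list ys; b is a filler value outside xs).
allFuns : ∀ {A B : Set} → DecidableEquality A → B → List A → List B → List (A → B)
allFuns eq b []       ys = [ (λ _ → b) ]
allFuns eq b (x ∷ xs) ys =
  concatMap (λ f → map (λ y a → if ⌊ eq a x ⌋ then y else f a) ys) (allFuns eq b xs ys)

-- All parent maps V → Maybe V, each exactly once (up to pointwise equality).
allPar : (d : ℕ) (n : Fin d → ℕ) → List (Par d n)
allPar d n = allFuns _≟V_ nothing (vertices d n) (nothing ∷ map just (vertices d n))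

data CountIs {A : Set} (P : A → Set) : List A → ℕ → Set where
  c-nil  : CountIs P [] zero
  c-yes  : ∀ {x xs m} → P x → CountIs P xs m → CountIs P (x ∷ xs) (suc m)
  c-no   : ∀ {x xs m} → ¬ P x → CountIs P xs m → CountIs P (x ∷ xs) m

CardT : (d : ℕ) (n : Fin d → ℕ) → Fin d → (Fin d → Vtx d n → ℤ) → ℕ → Set
CardT d n ρ β m = CountIs (InT ρ β) (allPar d n) m

shift : ∀ {d n} → (Fin d → Vtx d n → ℕ) → (s t : Fin d) → (i j : Fin (n t))
      → Fin d → Vtx d n → ℤ
shift γ s t i j a v with a ≟F s | v ≟V (t , i) | v ≟V (t , j)
... | yes _ | yes _ | _     = + γ a v - + 1
... | yes _ | no _  | yes _ = + γ a v + + 1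
... | _     | _     | _     = + γ a v

-- Double counting of the pairs (T, u) with T ∈ T_{ρ,γ} and u a type-s child of I = (t, i): there are
-- γ_{s,t,i} |T_{ρ,γ}| of them, and likewise γ′_{s,t,j} |T_{ρ,γ′}| pairs (T′, u′) with u′ a type-s
-- child of J = (t, j). They correspond bijectively: regraft u from I to J. If u is not an ancestor
-- of J the result is again a tree; if it is (this includes u = J), the regrafting would close a
-- cycle, which is undone by letting I and J, both of type t, also exchange their parents. Either
-- way one type-s child has moved from I to J, so the child numbers change from γ to γ′, and the
-- same construction with I and J exchanged is the inverse. Trees are enumerated as parent maps,
-- so the bijection is only defined up to pointwise equality and is counted by injections both ways.

module Submission where

open import Defs
open import Data.Nat using (ℕ; _≤_; _*_)
open import Data.Integer using (ℤ; +_) renaming (_*_ to _*ℤ_)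
open import Data.Fin using (Fin)
open import Data.Product using (_,_)
open import Relation.Binary.PropositionalEquality using (_≡_; _≢_)

open import Data.Bool using (true; false; if_then_else_)
open import Data.Empty using (⊥; ⊥-elim)
open import Data.Fin using (zero; suc) renaming (_≟_ to _≟F_)
open import Data.Fin.Properties using (injective⇒≤; suc-injective)
open import Data.Integer using (-_) renaming (_+_ to _+ℤ_)
import Data.Integer.Properties as ℤ
open import Data.List using (List; []; _∷_; map; concatMap; filter; length; lookup; _++_; allFin)
open import Data.List.Membership.Propositional using (_∈_)
open import Data.List.Membership.Propositional.Properties using (∈-map⁺; ∈-map⁻; ∈-allFin; ∈-concatMap⁺; ∈-lookup)
open import Data.List.Relation.Unary.All as All using (All; []; _∷_)
import Data.List.Relation.Unary.All.Properties as AllP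
open import Data.List.Relation.Unary.AllPairs as AllPairs using (AllPairs; []; _∷_)
import Data.List.Relation.Unary.AllPairs.Properties as AllPairsP
open import Data.List.Relation.Unary.Any as Any using (Any; here; there; index)
import Data.List.Relation.Unary.Any.Properties as AnyP
open import Data.List.Relation.Unary.Unique.Propositional using (Unique)
import Data.List.Relation.Unary.Unique.Propositional.Properties as Unique
open import Data.Maybe using (Maybe; nothing; just)
open import Data.Maybe.Properties using (just-injective)
import Data.Maybe.Properties as Maybe
open import Data.Nat using (zero; suc; _+_)
import Data.Nat.Properties as ℕ
open import Data.Product using (Σ; ∃-syntax; _×_; proj₁; proj₂)
open import Data.Sum as Sum using (_⊎_; inj₁; inj₂; [_,_]′)
open import Function using (_∘_; id)
open import Level using (0ℓ)
open import Relation.Binary.Bundles using (Setoid)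
open import Relation.Binary.Construct.Closure.ReflexiveTransitive as Star using (Star; ε; _◅_; _◅◅_)
open import Relation.Binary.Definitions using (DecidableEquality)
open import Relation.Binary.PropositionalEquality using (refl; sym; trans; cong; cong₂; subst; subst₂; _≗_; module ≡-Reasoning)
open import Relation.Nullary using (¬_; Dec; yes; no; does; ⌊_⌋)
open import Relation.Nullary.Decidable using (_×-dec_)
open import Relation.Unary using (Decidable)
open import Algebra.Properties.AbelianGroup ℤ.+-0-abelianGroup using (∙-cancelʳ)

private variable A B : Set

-- Counting the entries of a list

CountIs-++ : ∀ {P : A → Set} {xs ys a b} → CountIs P xs a → CountIs P ys b → CountIs P (xs ++ ys) (a + b)
CountIs-++ c-nil       c = c
CountIs-++ (c-yes p c) d = c-yes p (CountIs-++ c d)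
CountIs-++ (c-no p c)  d = c-no p (CountIs-++ c d)

CountIs-map : ∀ {P : B → Set} {f : A → B} {xs a} → CountIs (P ∘ f) xs a → CountIs P (map f xs) a
CountIs-map c-nil       = c-nil
CountIs-map (c-yes p c) = c-yes p (CountIs-map c)
CountIs-map (c-no p c)  = c-no p (CountIs-map c)

CountIs-cong : ∀ {P Q : A → Set} {xs a} → (∀ {x} → P x → Q x) → (∀ {x} → Q x → P x)
             → CountIs P xs a → CountIs Q xs a
CountIs-cong f g c-nil       = c-nil
CountIs-cong f g (c-yes p c) = c-yes (f p) (CountIs-cong f g c)
CountIs-cong f g (c-no p c)  = c-no (p ∘ g) (CountIs-cong f g c)

CountIs-none : ∀ {P : A → Set} xs → (∀ {x} → ¬ P x) → CountIs P xs 0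
CountIs-none []       ¬p = c-nil
CountIs-none (x ∷ xs) ¬p = c-no ¬p (CountIs-none xs ¬p)

CountIs-filter : ∀ {P : A → Set} (P? : Decidable P) xs → CountIs P xs (length (filter P? xs))
CountIs-filter P? [] = c-nil
CountIs-filter P? (x ∷ xs) with P? x
... | yes p = c-yes p (CountIs-filter P? xs)
... | no ¬p = c-no ¬p (CountIs-filter P? xs)

CountIs-concatMap : ∀ {P : A → Set} {Q : B → Set} {f : A → List B} {xs m c}
                  → (∀ {x} → P x → CountIs Q (f x) c) → (∀ {x} → ¬ P x → CountIs Q (f x) 0)
                  → CountIs P xs m → CountIs Q (concatMap f xs) (m * c)
CountIs-concatMap sat unsat c-nil       = c-nil
CountIs-concatMap sat unsat (c-yes p c) = CountIs-++ (sat p) (CountIs-concatMap sat unsat c)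
CountIs-concatMap sat unsat (c-no ¬p c) = CountIs-++ (unsat ¬p) (CountIs-concatMap sat unsat c)

χ : ∀ {Q : Set} → Dec Q → ℕ
χ q = if does q then 1 else 0

χ-yes : ∀ {Q : Set} (q : Dec Q) → Q → χ q ≡ 1
χ-yes (yes _) _  = refl
χ-yes (no ¬q) q  = ⊥-elim (¬q q)

χ-no : ∀ {Q : Set} (q : Dec Q) → ¬ Q → χ q ≡ 0
χ-no (yes q) ¬q = ⊥-elim (¬q q)
χ-no (no _)  _  = refl

module _ {A : Set} {P Q : A → Set} (P? : Decidable P) (Q? : Decidable Q) where

  private
    count : ∀ {R : A → Set} → Decidable R → List A → ℕ
    count R? L = length (filter R? L)

    count-∷ : ∀ {R : A → Set} (R? : Decidable R) a L → count R? (a ∷ L) ≡ χ (R? a) + count R? L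
    count-∷ R? a L with does (R? a)
    ... | true  = refl
    ... | false = refl

  count-cong : ∀ {L} → All (λ a → does (P? a) ≡ does (Q? a)) L → count P? L ≡ count Q? L
  count-cong {[]}    []         = refl
  count-cong {a ∷ L} (pa≡qa ∷ h) = begin
    count P? (a ∷ L)         ≡⟨ count-∷ P? a L ⟩
    χ (P? a) + count P? L    ≡⟨ cong₂ _+_ (cong (λ b → if b then 1 else 0) pa≡qa) (count-cong h) ⟩
    χ (Q? a) + count Q? L    ≡⟨ count-∷ Q? a L ⟨
    count Q? (a ∷ L)         ∎
    where open ≡-Reasoning

  count-update : ∀ {L x} → Unique L → x ∈ L → (∀ {a} → a ≢ x → does (P? a) ≡ does (Q? a))
               → count Q? L + χ (P? x) ≡ count P? L + χ (Q? x)
  count-update {x ∷ L} {x} (x∉L ∷ _) (here refl) agree = begin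
    count Q? (x ∷ L) + χ (P? x)          ≡⟨ cong (_+ χ (P? x)) (count-∷ Q? x L) ⟩
    (χ (Q? x) + count Q? L) + χ (P? x)   ≡⟨ cong (λ c → (χ (Q? x) + c) + χ (P? x)) (count-cong agree-on-L) ⟨
    (χ (Q? x) + count P? L) + χ (P? x)   ≡⟨ ℕ.+-comm (χ (Q? x) + count P? L) (χ (P? x)) ⟩
    χ (P? x) + (χ (Q? x) + count P? L)   ≡⟨ cong (_+_ (χ (P? x))) (ℕ.+-comm (χ (Q? x)) (count P? L)) ⟩
    χ (P? x) + (count P? L + χ (Q? x))   ≡⟨ ℕ.+-assoc (χ (P? x)) (count P? L) (χ (Q? x)) ⟨
    (χ (P? x) + count P? L) + χ (Q? x)   ≡⟨ cong (_+ χ (Q? x)) (count-∷ P? x L) ⟨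
    count P? (x ∷ L) + χ (Q? x)          ∎
    where
    open ≡-Reasoning
    agree-on-L : All (λ a → does (P? a) ≡ does (Q? a)) L
    agree-on-L = All.map (λ x≢a → agree (x≢a ∘ sym)) x∉L
  count-update {a ∷ L} {x} (a∉L ∷ uL) (there x∈L) agree = begin
    count Q? (a ∷ L) + χ (P? x)          ≡⟨ cong (_+ χ (P? x)) (count-∷ Q? a L) ⟩
    (χ (Q? a) + count Q? L) + χ (P? x)   ≡⟨ ℕ.+-assoc (χ (Q? a)) _ _ ⟩
    χ (Q? a) + (count Q? L + χ (P? x))   ≡⟨ cong₂ _+_ (cong (λ b → if b then 1 else 0) (sym (agree a≢x)))
                                                       (count-update uL x∈L agree) ⟩
    χ (P? a) + (count P? L + χ (Q? x))   ≡⟨ ℕ.+-assoc (χ (P? a)) _ _ ⟨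
    (χ (P? a) + count P? L) + χ (Q? x)   ≡⟨ cong (_+ χ (Q? x)) (count-∷ P? a L) ⟨
    count P? (a ∷ L) + χ (Q? x)          ∎
    where
    open ≡-Reasoning
    a≢x : a ≢ x
    a≢x = All.lookup a∉L x∈L

module _ {P : A → Set} where

  -- select c k is the position of the k-th entry satisfying P, and rank c q is its inverse.
  select : ∀ {xs m} → CountIs P xs m → Fin m → Fin (length xs)
  select (c-yes p c) zero    = zero
  select (c-yes p c) (suc k) = suc (select c k)
  select (c-no ¬p c) k       = suc (select c k)

  select-sat : ∀ {xs m} (c : CountIs P xs m) k → P (lookup xs (select c k))
  select-sat (c-yes p c) zero    = p
  select-sat (c-yes p c) (suc k) = select-sat c k
  select-sat (c-no ¬p c) k       = select-sat c k

  select-injective : ∀ {xs m} (c : CountIs P xs m) {k l} → select c k ≡ select c l → k ≡ l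
  select-injective (c-yes p c) {zero}  {zero}  e = refl
  select-injective (c-yes p c) {suc k} {suc l} e = cong suc (select-injective c (suc-injective e))
  select-injective (c-no ¬p c)                 e = select-injective c (suc-injective e)

  rank : ∀ {xs m} → CountIs P xs m → (q : Fin (length xs)) → P (lookup xs q) → Fin m
  rank (c-yes p c)  zero    pq = zero
  rank (c-yes p c)  (suc q) pq = suc (rank c q pq)
  rank (c-no ¬p c)  zero    pq = ⊥-elim (¬p pq)
  rank (c-no ¬p c)  (suc q) pq = rank c q pq

  rank-injective : ∀ {xs m} (c : CountIs P xs m) q r pq pr → rank c q pq ≡ rank c r pr → q ≡ r
  rank-injective (c-yes p c) zero    zero    pq pr e = refl
  rank-injective (c-yes p c) (suc q) (suc r) pq pr e = cong suc (rank-injective c q r pq pr (suc-injective e))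
  rank-injective (c-no ¬p c) zero    r       pq pr e = ⊥-elim (¬p pq)
  rank-injective (c-no ¬p c) (suc q) zero    pq pr e = ⊥-elim (¬p pr)
  rank-injective (c-no ¬p c) (suc q) (suc r) pq pr e = cong suc (rank-injective c q r pq pr e)

module Counting (S : Setoid 0ℓ 0ℓ) where
  open Setoid S using (Carrier; _≈_) renaming (sym to ≈-sym; trans to ≈-trans)

  lookup-injective : ∀ {L} → AllPairs (λ x y → ¬ x ≈ y) L → ∀ q r → lookup L q ≈ lookup L r → q ≡ r
  lookup-injective (h ∷ hs) zero    zero    e = refl
  lookup-injective (h ∷ hs) zero    (suc r) e = ⊥-elim (All.lookup h (∈-lookup r) e)
  lookup-injective (h ∷ hs) (suc q) zero    e = ⊥-elim (All.lookup h (∈-lookup q) (≈-sym e))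
  lookup-injective (h ∷ hs) (suc q) (suc r) e = cong suc (lookup-injective hs q r e)

  module _ {L : List Carrier} (distinct : AllPairs (λ x y → ¬ x ≈ y) L) (complete : ∀ x → Any (_≈ x) L) where

    count-≤ : ∀ {P Q : Carrier → Set} {m k} → CountIs P L m → CountIs Q L k
            → (∀ {x y} → x ≈ y → Q x → Q y)
            → (f : ∀ x → P x → Carrier) → (∀ x px → Q (f x px))
            → (∀ x y px py → f x px ≈ f y py → x ≈ y)
            → m ≤ k
    count-≤ {P} {Q} {m} {k} cP cQ Q-resp f f-sat f-inj = injective⇒≤ {f = h} h-injective
      where
      x : ∀ l → Carrier
      x l = lookup L (select cP l)
      y : ∀ l → Carrier
      y l = f (x l) (select-sat cP l)
      pos : ∀ l → Any (_≈ y l) L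
      pos l = complete (y l)
      h : Fin m → Fin k
      h l = rank cQ (index (pos l)) (Q-resp (≈-sym (AnyP.lookup-index (pos l))) (f-sat _ _))
      h-injective : ∀ {k l} → h k ≡ h l → k ≡ l
      h-injective {k} {l} e = select-injective cP (lookup-injective distinct _ _ (f-inj _ _ _ _ yk≈yl))
        where
        same : index (pos k) ≡ index (pos l)
        same = rank-injective cQ _ _ _ _ e
        yk≈yl : y k ≈ y l
        yk≈yl = ≈-trans (≈-sym (AnyP.lookup-index (pos k)))
                  (subst (λ q → lookup L q ≈ y l) (sym same) (AnyP.lookup-index (pos l)))

    count-≡ : ∀ {P Q : Carrier → Set} {m k} → CountIs P L m → CountIs Q L k
            → (∀ {x y} → x ≈ y → P x → P y) → (∀ {x y} → x ≈ y → Q x → Q y)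
            → (f : ∀ x → P x → Carrier) (f-sat : ∀ x px → Q (f x px))
            → (g : ∀ x → Q x → Carrier) (g-sat : ∀ x qx → P (g x qx))
            → (∀ x y px py → x ≈ y → f x px ≈ f y py)
            → (∀ x y qx qy → x ≈ y → g x qx ≈ g y qy)
            → (∀ x px → g (f x px) (f-sat x px) ≈ x)
            → (∀ x qx → f (g x qx) (g-sat x qx) ≈ x)
            → m ≡ k
    count-≡ cP cQ P-resp Q-resp f f-sat g g-sat f-cong g-cong gf fg =
      ℕ.≤-antisym (count-≤ cP cQ Q-resp f f-sat f-inj) (count-≤ cQ cP P-resp g g-sat g-inj)
      where
      f-inj : ∀ x y px py → f x px ≈ f y py → x ≈ y
      f-inj x y px py e = ≈-trans (≈-sym (gf x px)) (≈-trans (g-cong _ _ _ _ e) (gf y py))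
      g-inj : ∀ x y qx qy → g x qx ≈ g y qy → x ≈ y
      g-inj x y qx qy e = ≈-trans (≈-sym (fg x qx)) (≈-trans (f-cong _ _ _ _ e) (fg y qy))

-- Enumerations of functions and of marked parent maps

AllPairs-concatMap⁺ : ∀ {R : B → B → Set} {f : A → List B} {xs}
                    → All (AllPairs R ∘ f) xs
                    → AllPairs (λ x y → ∀ {a b} → a ∈ f x → b ∈ f y → R a b) xs
                    → AllPairs R (concatMap f xs)
AllPairs-concatMap⁺ within across =
  AllPairsP.concat⁺ (AllP.map⁺ within)
    (AllPairsP.map⁺ (AllPairs.map (λ h → All.tabulate (λ a∈ → All.tabulate (λ b∈ → h a∈ b∈))) across))

update : DecidableEquality A → (A → B) → A → B → A → B
update _≟_ f x y a = if ⌊ a ≟ x ⌋ then y else f a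

update-same : ∀ (_≟_ : DecidableEquality A) (f : A → B) x y → update _≟_ f x y x ≡ y
update-same _≟_ f x y with x ≟ x
... | yes _  = refl
... | no x≢x = ⊥-elim (x≢x refl)

update-other : ∀ (_≟_ : DecidableEquality A) (f : A → B) {x} y {a} → a ≢ x → update _≟_ f x y a ≡ f a
update-other _≟_ f {x} y {a} a≢x with a ≟ x
... | yes a≡x = ⊥-elim (a≢x a≡x)
... | no _    = refl

update-cong : ∀ (_≟_ : DecidableEquality A) {f g : A → B} → f ≗ g → ∀ x {y y′} → y ≡ y′
            → update _≟_ f x y ≗ update _≟_ g x y′
update-cong _≟_ f≗g x y≡y′ a with a ≟ x
... | yes _ = y≡y′
... | no _  = f≗g a

update-overwrite : ∀ (_≟_ : DecidableEquality A) (f : A → B) x y y′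
                 → update _≟_ (update _≟_ f x y) x y′ ≗ update _≟_ f x y′
update-overwrite _≟_ f x y y′ a with a ≟ x
... | yes _ = refl
... | no _  = refl

update-self : ∀ (_≟_ : DecidableEquality A) (f : A → B) {x y} → f x ≡ y → update _≟_ f x y ≗ f
update-self _≟_ f {x} e a with a ≟ x
... | yes refl = sym e
... | no _     = refl

module _ {A B : Set} (_≟_ : DecidableEquality A) (b : B) (ys : List B) where

  allFuns-complete : ∀ (g : A → B) → (∀ a → g a ∈ ys) → ∀ xs
                   → Any (λ f → ∀ {a} → a ∈ xs → f a ≡ g a) (allFuns _≟_ b xs ys)
  allFuns-complete g g∈ys []       = here (λ ())
  allFuns-complete g g∈ys (x ∷ xs) =
    AnyP.concatMap⁺ (λ f → map (update _≟_ f x) ys) (Any.map extend (allFuns-complete g g∈ys xs))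
    where
    extend : ∀ {f} → (∀ {a} → a ∈ xs → f a ≡ g a)
           → Any (λ f′ → ∀ {a} → a ∈ x ∷ xs → f′ a ≡ g a) (map (update _≟_ f x) ys)
    extend {f} agree = AnyP.map⁺ (Any.map agree′ (g∈ys x))
      where
      agree′ : ∀ {y} → g x ≡ y → ∀ {a} → a ∈ x ∷ xs → update _≟_ f x y a ≡ g a
      agree′ gx≡y {a} a∈ with a ≟ x | a∈
      ... | yes refl | _          = sym gx≡y
      ... | no a≢x   | here a≡x   = ⊥-elim (a≢x a≡x)
      ... | no a≢x   | there a∈xs = agree a∈xs

  allFuns-distinct : Unique ys → ∀ {xs} → Unique xs
                   → AllPairs (λ f g → ∃[ a ] a ∈ xs × f a ≢ g a) (allFuns _≟_ b xs ys)
  allFuns-distinct uys {[]}     []           = [] ∷ []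
  allFuns-distinct uys {x ∷ xs} (x∉xs ∷ uxs) =
    AllPairs-concatMap⁺ (All.tabulate (λ _ → within)) (AllPairs.map across (allFuns-distinct uys uxs))
    where
    Differ : (A → B) → (A → B) → Set
    Differ f g = ∃[ a ] a ∈ x ∷ xs × f a ≢ g a

    within : ∀ {f} → AllPairs Differ (map (update _≟_ f x) ys)
    within {f} = AllPairsP.map⁺ (AllPairs.map
      (λ {y} {y′} y≢y′ → x , here refl ,
         λ e → y≢y′ (trans (sym (update-same _≟_ f x y)) (trans e (update-same _≟_ f x y′))))
      uys)

    across : ∀ {f g} → (∃[ a ] a ∈ xs × f a ≢ g a)
           → ∀ {u v} → u ∈ map (update _≟_ f x) ys → v ∈ map (update _≟_ g x) ys → Differ u v
    across {f} {g} (a , a∈xs , fa≢ga) u∈ v∈ with ∈-map⁻ (update _≟_ f x) u∈ | ∈-map⁻ (update _≟_ g x) v∈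
    ... | y , _ , refl | y′ , _ , refl =
      a , there a∈xs , λ e → fa≢ga (trans (sym (update-other _≟_ f y a≢x)) (trans e (update-other _≟_ g y′ a≢x)))
      where
      a≢x : a ≢ x
      a≢x a≡x = All.lookup x∉xs a∈xs (sym a≡x)

module _ {d : ℕ} {n : Fin d → ℕ} where

  private
    V : Set
    V = Vtx d n
    P : Set
    P = Par d n

  ∈-vertices : ∀ v → v ∈ vertices d n
  ∈-vertices (t , i) = ∈-concatMap⁺ (λ t → map (t ,_) (allFin (n t)))
    (Any.map (λ { refl → ∈-map⁺ (t ,_) (∈-allFin i) }) (∈-allFin t))

  vertices-unique : Unique (vertices d n)
  vertices-unique = AllPairs-concatMap⁺
    (All.tabulate (λ {t} _ → Unique.map⁺ (λ { refl → refl }) (Unique.allFin⁺ (n t))))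
    (AllPairs.map across (Unique.allFin⁺ d))
    where
    across : ∀ {t t′} → t ≢ t′
           → ∀ {v w} → v ∈ map (t ,_) (allFin (n t)) → w ∈ map (t′ ,_) (allFin (n t′)) → v ≢ w
    across t≢t′ v∈ w∈ v≡w with ∈-map⁻ _ v∈ | ∈-map⁻ _ w∈
    ... | _ , _ , refl | _ , _ , refl = t≢t′ (cong proj₁ v≡w)

  _≈ₘ_ : P × V → P × V → Set
  (p , u) ≈ₘ (q , v) = p ≗ q × u ≡ v

  marked-setoid : Setoid 0ℓ 0ℓ
  marked-setoid = record
    { Carrier = P × V
    ; _≈_ = _≈ₘ_
    ; isEquivalence = record
      { refl  = (λ _ → refl) , refl
      ; sym   = λ (p≗q , u≡v) → sym ∘ p≗q , sym u≡v
      ; trans = λ (p≗q , u≡v) (q≗r , v≡w) → (λ x → trans (p≗q x) (q≗r x)) , trans u≡v v≡w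
      }
    }

  marked : List (P × V)
  marked = concatMap (λ p → map (p ,_) (vertices d n)) (allPar d n)

  private
    maybe-vertices : List (Maybe V)
    maybe-vertices = nothing ∷ map just (vertices d n)

    maybe-vertices-unique : Unique maybe-vertices
    maybe-vertices-unique = AllP.map⁺ (All.tabulate (λ _ ())) ∷ Unique.map⁺ (λ { refl → refl }) vertices-unique

    ∈-maybe-vertices : ∀ m → m ∈ maybe-vertices
    ∈-maybe-vertices nothing  = here refl
    ∈-maybe-vertices (just v) = there (∈-map⁺ just (∈-vertices v))

  marked-distinct : AllPairs (λ x y → ¬ x ≈ₘ y) marked
  marked-distinct = AllPairs-concatMap⁺
    (All.tabulate (λ _ → AllPairsP.map⁺ (AllPairs.map (λ u≢v (_ , u≡v) → u≢v u≡v) vertices-unique)))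
    (AllPairs.map across (allFuns-distinct _≟V_ nothing maybe-vertices maybe-vertices-unique vertices-unique))
    where
    across : ∀ {p q} → (∃[ v ] v ∈ vertices d n × p v ≢ q v)
           → ∀ {x y} → x ∈ map (p ,_) (vertices d n) → y ∈ map (q ,_) (vertices d n) → ¬ x ≈ₘ y
    across (v , _ , pv≢qv) x∈ y∈ with ∈-map⁻ _ x∈ | ∈-map⁻ _ y∈
    ... | _ , _ , refl | _ , _ , refl = λ (p≗q , _) → pv≢qv (p≗q v)

  marked-complete : ∀ x → Any (_≈ₘ x) marked
  marked-complete (q , v) = AnyP.concatMap⁺ (λ p → map (p ,_) (vertices d n))
    (Any.map (λ agree → AnyP.map⁺ (Any.map (λ { refl → (λ w → agree (∈-vertices w)) , refl }) (∈-vertices v)))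
      (allFuns-complete _≟V_ nothing maybe-vertices q (∈-maybe-vertices ∘ q) (vertices d n)))

-- Parent maps, paths to the root and child counts

module _ {d : ℕ} {n : Fin d → ℕ} where

  private
    V : Set
    V = Vtx d n
    P : Set
    P = Par d n

  _[_≔_] : P → V → Maybe V → P
  p [ x ≔ m ] = update _≟V_ p x m

  swap : P → V → V → P
  swap p x y = (p [ x ≔ p y ]) [ y ≔ p x ]

  -- A with on v ≟V w would also abstract the copies of v ≟V w hidden in updated parent maps.
  vertex-cases : ∀ {C : Set} (v w : V) → (v ≡ w → C) → (v ≢ w → C) → C
  vertex-cases v w if-≡ if-≢ with v ≟V w
  ... | yes v≡w = if-≡ v≡w
  ... | no v≢w  = if-≢ v≢w

  swap-left : ∀ (p : P) {x y} → x ≢ y → swap p x y x ≡ p y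
  swap-left p {x} {y} x≢y = trans (update-other _≟V_ (p [ x ≔ p y ]) (p x) x≢y) (update-same _≟V_ p x (p y))

  swap-right : ∀ (p : P) x y → swap p x y y ≡ p x
  swap-right p x y = update-same _≟V_ (p [ x ≔ p y ]) y (p x)

  swap-other : ∀ (p : P) {x y v} → v ≢ x → v ≢ y → swap p x y v ≡ p v
  swap-other p {x} {y} v≢x v≢y = trans (update-other _≟V_ (p [ x ≔ p y ]) (p x) v≢y) (update-other _≟V_ p (p y) v≢x)

  swap-cong : ∀ {p q : P} → p ≗ q → ∀ x y → swap p x y ≗ swap q x y
  swap-cong p≗q x y = update-cong _≟V_ (update-cong _≟V_ p≗q x (p≗q y)) y (p≗q x)

  transpose : V → V → V → V
  transpose x y v with v ≟V x | v ≟V y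
  ... | yes _ | _     = y
  ... | no _  | yes _ = x
  ... | no _  | no _  = v

  transpose-type : ∀ {x y} → proj₁ x ≡ proj₁ y → ∀ v → proj₁ (transpose x y v) ≡ proj₁ v
  transpose-type {x} {y} tx≡ty v with v ≟V x | v ≟V y
  ... | yes refl | _        = sym tx≡ty
  ... | no _     | yes refl = tx≡ty
  ... | no _     | no _     = refl

  transpose-left : ∀ x y → transpose x y x ≡ y
  transpose-left x y with x ≟V x
  ... | yes _  = refl
  ... | no x≢x = ⊥-elim (x≢x refl)

  transpose-right : ∀ {x y} → x ≢ y → transpose x y y ≡ x
  transpose-right {x} {y} x≢y with y ≟V x | y ≟V y
  ... | yes y≡x | _      = ⊥-elim (x≢y (sym y≡x))
  ... | no _    | yes _  = refl
  ... | no _    | no y≢y = ⊥-elim (y≢y refl)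

  transpose-other : ∀ {x y v} → v ≢ x → v ≢ y → transpose x y v ≡ v
  transpose-other {x} {y} {v} v≢x v≢y with v ≟V x | v ≟V y
  ... | yes v≡x | _       = ⊥-elim (v≢x v≡x)
  ... | no _    | yes v≡y = ⊥-elim (v≢y v≡y)
  ... | no _    | no _    = refl

  transpose-involutive : ∀ x y v → transpose x y (transpose x y v) ≡ v
  transpose-involutive x y v =
    vertex-cases v x (λ { refl → trans (cong (transpose v y) (transpose-left v y))
                                   (vertex-cases v y (λ { refl → transpose-left v v }) transpose-right) }) λ v≢x →
    vertex-cases v y (λ { refl → trans (cong (transpose x v) (transpose-right (v≢x ∘ sym)))
                                   (transpose-left x v) }) λ v≢y →
    trans (cong (transpose x y) (transpose-other v≢x v≢y)) (transpose-other v≢x v≢y)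

  Parent : P → V → V → Set
  Parent p v w = p v ≡ just w

  Path : P → V → V → Set
  Path p = Star (Parent p)

  data ReachesRoot (p : P) : V → Set where
    at-root : ∀ {v}   → p v ≡ nothing → ReachesRoot p v
    via     : ∀ {v w} → Parent p v w → ReachesRoot p w → ReachesRoot p v

  HasRoot : Fin d → P → Set
  HasRoot ρ p = Σ V λ r → proj₁ r ≡ ρ × p r ≡ nothing × (∀ v → p v ≡ nothing → v ≡ r)

  nothing≢just : ∀ {v : V} → nothing ≢ just v
  nothing≢just ()

  iter⇒ReachesRoot : ∀ {p} k {v} → iter p k (just v) ≡ nothing → ReachesRoot p v
  iter⇒ReachesRoot         zero    ()
  iter⇒ReachesRoot {p} (suc k) {v} e with p v in pv
  ... | nothing = at-root pv
  ... | just w  = via pv (iter⇒ReachesRoot k e)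

  ReachesRoot⇒iter : ∀ {p v} → ReachesRoot p v → ∃[ k ] iter p k (just v) ≡ nothing
  ReachesRoot⇒iter     (at-root e) = 1 , e
  ReachesRoot⇒iter {p} (via e r) with ReachesRoot⇒iter r
  ... | k , ek = suc k , trans (cong (iter p k) e) ek

  IsRootedTree⁻ : ∀ {ρ p} → IsRootedTree ρ p → HasRoot ρ p × (∀ v → ReachesRoot p v)
  IsRootedTree⁻ {ρ} (r , r-root , r-unique , reach) =
    ((ρ , r) , refl , r-root , r-unique) , λ v → iter⇒ReachesRoot (proj₁ (reach v)) (proj₂ (reach v))

  IsRootedTree⁺ : ∀ {ρ p} → HasRoot ρ p → (∀ v → ReachesRoot p v) → IsRootedTree ρ p
  IsRootedTree⁺ ((_ , r) , refl , r-root , r-unique) reach = r , r-root , r-unique , ReachesRoot⇒iter ∘ reach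

  iter-cong : ∀ {p q : P} → p ≗ q → ∀ k m → iter p k m ≡ iter q k m
  iter-cong p≗q zero    m        = refl
  iter-cong p≗q (suc k) nothing  = refl
  iter-cong {p} p≗q (suc k) (just v) = trans (iter-cong p≗q k (p v)) (cong (iter _ k) (p≗q v))

  IsRootedTree-cong : ∀ {ρ p q} → p ≗ q → IsRootedTree ρ p → IsRootedTree ρ q
  IsRootedTree-cong p≗q (r , r-root , r-unique , reach) =
      r , trans (sym (p≗q _)) r-root , (λ v e → r-unique v (trans (p≗q v) e))
    , λ v → proj₁ (reach v) , trans (sym (iter-cong p≗q (proj₁ (reach v)) (just v))) (proj₂ (reach v))

  HasRoot-transport : ∀ {ρ p p′} (σ : V → V) → (∀ v → proj₁ (σ v) ≡ proj₁ v) → (∀ v → σ (σ v) ≡ v)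
                    → (∀ v → p′ v ≡ nothing → p (σ v) ≡ nothing)
                    → (∀ v → p v ≡ nothing → p′ (σ v) ≡ nothing)
                    → HasRoot ρ p → HasRoot ρ p′
  HasRoot-transport σ σ-type σσ to from (r , r-type , r-root , r-unique) =
    σ r , trans (σ-type r) r-type , from r r-root , λ v e → trans (sym (σσ v)) (cong σ (r-unique (σ v) (to v e)))

  no-cycle : ∀ {p v w} → ReachesRoot p v → Parent p v w → ¬ Path p w v
  no-cycle (at-root e) e′ _ = nothing≢just (trans (sym e) e′)
  no-cycle (via e r) e′ path with just-injective (trans (sym e) e′)
  ... | refl with path
  ...   | ε         = no-cycle r e ε
  ...   | e″ ◅ rest = no-cycle r e″ (rest ◅◅ (e ◅ ε))

  Path? : ∀ {p v} → ReachesRoot p v → ∀ w → Dec (Path p v w)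
  Path? {v = v} r w with v ≟V w
  ... | yes refl = yes ε
  Path? (at-root e) w | no v≢w = no λ { ε → v≢w refl ; (e′ ◅ _) → nothing≢just (trans (sym e) e′) }
  Path? (via e r) w | no v≢w with Path? r w
  ... | yes path = yes (e ◅ path)
  ... | no ¬path = no λ { ε → v≢w refl
                        ; (e′ ◅ path) → ¬path (subst (λ x → Path _ x w) (just-injective (trans (sym e′) e)) path) }

  Path-cong : ∀ {p q v w} → p ≗ q → Path p v w → Path q v w
  Path-cong p≗q = Star.map (λ e → trans (sym (p≗q _)) e)

  ReachesRoot-transfer : ∀ {p p′ v} → ReachesRoot p v → (∀ {w} → Path p v w → p′ w ≡ p w) → ReachesRoot p′ v
  ReachesRoot-transfer (at-root e) agree = at-root (trans (agree ε) e)
  ReachesRoot-transfer (via e r)   agree = via (trans (agree ε) e) (ReachesRoot-transfer r (agree ∘ (e ◅_)))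

  ReachesRoot-patch : ∀ {p p′} → (∀ v → ReachesRoot p′ v ⊎ p′ v ≡ p v)
                    → ∀ {v} → ReachesRoot p v → ReachesRoot p′ v
  ReachesRoot-patch h {v} r with h v
  ... | inj₁ r′ = r′
  ReachesRoot-patch h (at-root e) | inj₂ same = at-root (trans same e)
  ReachesRoot-patch h (via e r)   | inj₂ same = via (trans same e) (ReachesRoot-patch h r)

  Path-transfer : ∀ {p p′ a w} → Path p a w
                → (∀ {v} → Path p a v → Path p v w → v ≢ w → p′ v ≡ p v) → Path p′ a w
  Path-transfer ε agree = ε
  Path-transfer {a = a} {w} (e ◅ path) agree with a ≟V w
  ... | yes refl = ε
  ... | no a≢w   = trans (agree ε (e ◅ path) a≢w) e ◅ Path-transfer path (λ av vw → agree (e ◅ av) vw)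

  Path-update⁻ : ∀ {p p′ x a w} → (∀ {v} → v ≢ x → p′ v ≡ p v) → Path p′ a w → Path p a w ⊎ Path p a x
  Path-update⁻ agree ε = inj₁ ε
  Path-update⁻ {p} {x = x} {a} agree (_◅_ {j = y} e path) with a ≟V x
  ... | yes refl = inj₂ ε
  ... | no a≢x   = Sum.map (e′ ◅_) (e′ ◅_) (Path-update⁻ agree path)
    where
    e′ : Parent p a y
    e′ = trans (sym (agree a≢x)) e

  edge? : (a : Fin d) (w : V) (t : Fin d) (m : Maybe V) → Dec (t ≡ a × m ≡ just w)
  edge? a w t m = (t ≟F a) ×-dec Maybe.≡-dec _≟V_ m (just w)

  ch-cong : ∀ {p q} → p ≗ q → ∀ a w → ch p a w ≡ ch q a w
  ch-cong {p} {q} p≗q a w = count-cong (λ u → edge? a w (proj₁ u) (p u)) (λ u → edge? a w (proj₁ u) (q u))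
    {vertices d n} (All.tabulate (λ {u} _ → cong (does ∘ edge? a w (proj₁ u)) (p≗q u)))

  ch-update : ∀ p x m a w
            → ch (p [ x ≔ m ]) a w + χ (edge? a w (proj₁ x) (p x)) ≡ ch p a w + χ (edge? a w (proj₁ x) m)
  ch-update p x m a w =
    subst (λ m′ → ch (p [ x ≔ m ]) a w + χ (edge? a w (proj₁ x) (p x)) ≡ ch p a w + χ (edge? a w (proj₁ x) m′))
      (update-same _≟V_ p x m)
      (count-update (λ u → edge? a w (proj₁ u) (p u)) (λ u → edge? a w (proj₁ u) ((p [ x ≔ m ]) u))
        vertices-unique (∈-vertices x)
        (λ {u} u≢x → cong (does ∘ edge? a w (proj₁ u)) (sym (update-other _≟V_ p m u≢x))))

  ch-swap : ∀ p {x y} → proj₁ x ≡ proj₁ y → x ≢ y → ∀ a w → ch (swap p x y) a w ≡ ch p a w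
  ch-swap p {x} {y} tx≡ty x≢y a w = ℕ.+-cancelʳ-≡ (E (proj₁ y) (p y)) _ _ (begin
    ch (swap p x y) a w + E (proj₁ y) (p y)     ≡⟨ cong (λ m → ch (swap p x y) a w + E (proj₁ y) m) p′y≡py ⟨
    ch (swap p x y) a w + E (proj₁ y) (p′ y)    ≡⟨ ch-update p′ y (p x) a w ⟩
    ch p′ a w + E (proj₁ y) (p x)               ≡⟨ cong (λ t → ch p′ a w + E t (p x)) tx≡ty ⟨
    ch p′ a w + E (proj₁ x) (p x)               ≡⟨ ch-update p x (p y) a w ⟩
    ch p a w + E (proj₁ x) (p y)                ≡⟨ cong (λ t → ch p a w + E t (p y)) tx≡ty ⟩
    ch p a w + E (proj₁ y) (p y)                ∎)
    where
    open ≡-Reasoning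
    p′ : P
    p′ = p [ x ≔ p y ]
    p′y≡py : p′ y ≡ p y
    p′y≡py = update-other _≟V_ p (p y) (x≢y ∘ sym)
    E : Fin d → Maybe V → ℕ
    E t m = χ (edge? a w t m)

  label-≢ : ∀ {t} {i j : Fin (n t)} → i ≢ j → _≢_ {A = V} (t , i) (t , j)
  label-≢ i≢j refl = i≢j refl

  χ-edge-yes : ∀ {a s : Fin d} {w x : V} → a ≡ s → w ≡ x → χ (edge? a w s (just x)) ≡ 1
  χ-edge-yes {a} {s} {w} {x} a≡s w≡x = χ-yes (edge? a w s (just x)) (sym a≡s , cong just (sym w≡x))

  χ-edge-no : ∀ {a s : Fin d} {w x : V} → ¬ (a ≡ s × w ≡ x) → χ (edge? a w s (just x)) ≡ 0
  χ-edge-no {a} {s} {w} {x} ¬e = χ-no (edge? a w s (just x)) (λ (s≡a , e) → ¬e (sym s≡a , sym (just-injective e)))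

  -- One type-s child moves from x to y; stated additively, so that no subtraction is needed.
  ChildMove : Fin d → V → V → P → P → Set
  ChildMove s x y p p′ = ∀ a w → ch p′ a w + χ (edge? a w s (just x)) ≡ ch p a w + χ (edge? a w s (just y))

  Moves : Fin d → V → V → (Fin d → V → ℤ) → (Fin d → V → ℤ) → Set
  Moves s x y β β′ = ∀ a w → β′ a w +ℤ + χ (edge? a w s (just x)) ≡ β a w +ℤ + χ (edge? a w s (just y))

  ch-moves : ∀ {s x y p p′ β β′} → ChildMove s x y p p′ → Moves s x y β β′
           → (∀ a w → + ch p a w ≡ β a w) → ∀ a w → + ch p′ a w ≡ β′ a w
  ch-moves {s} {x} {y} {p} {p′} {β} {β′} mv Mv counts a w =
    ∙-cancelʳ (+ χ (edge? a w s (just x))) (+ ch p′ a w) (β′ a w)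
      (trans (cong +_ (mv a w)) (trans (cong (_+ℤ + χ (edge? a w s (just y))) (counts a w)) (sym (Mv a w))))

  ChildPair : Fin d → Fin d → (Fin d → V → ℤ) → V → P × V → Set
  ChildPair ρ s β x (p , u) = InT ρ β p × proj₁ u ≡ s × p u ≡ just x

  ChildPair-cong : ∀ {ρ s β x y z} → y ≈ₘ z → ChildPair ρ s β x y → ChildPair ρ s β x z
  ChildPair-cong {y = p , u} {q , .u} (p≗q , refl) ((tree , counts) , tu , pu) =
    (IsRootedTree-cong p≗q tree , λ a w → trans (cong +_ (sym (ch-cong p≗q a w))) (counts a w))
    , tu , trans (sym (p≗q _)) pu

  count-ChildPair : ∀ {ρ s β m c} x → (∀ {p} → InT ρ β p → ch p s x ≡ c)
                  → CountIs (InT ρ β) (allPar d n) m → CountIs (ChildPair ρ s β x) marked (m * c)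
  count-ChildPair {s = s} x ch≡c = CountIs-concatMap
    (λ {p} tree → CountIs-map (subst (CountIs _ _) (ch≡c tree)
                    (CountIs-cong (tree ,_) proj₂ (CountIs-filter (λ u → edge? s x (proj₁ u) (p u)) (vertices d n)))))
    (λ ¬tree → CountIs-map (CountIs-none _ (¬tree ∘ proj₁)))

shift-moves : ∀ {d n} (γ : Fin d → Vtx d n → ℕ) (s t : Fin d) {i j : Fin (n t)} → i ≢ j
            → Moves s (t , i) (t , j) (λ a v → + γ a v) (shift γ s t i j)
shift-moves γ s t {i} {j} i≢j a w with a ≟F s | w ≟V (t , i) | w ≟V (t , j)
... | yes a≡s | yes w≡I | _
  rewrite χ-edge-yes a≡s w≡I
        | χ-edge-no {a = a} {s} {w} {t , j} (λ (_ , w≡J) → label-≢ i≢j (trans (sym w≡I) w≡J))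
  = ℤ.+-assoc (+ γ a w) (- + 1) (+ 1)
... | yes a≡s | no w≢I | yes w≡J
  rewrite χ-edge-no {a = a} {s} {w} {t , i} (λ (_ , w≡I) → w≢I w≡I) | χ-edge-yes a≡s w≡J
  = cong +_ (ℕ.+-identityʳ _)
... | yes a≡s | no w≢I | no w≢J
  rewrite χ-edge-no {a = a} {s} {w} {t , i} (λ (_ , w≡I) → w≢I w≡I)
        | χ-edge-no {a = a} {s} {w} {t , j} (λ (_ , w≡J) → w≢J w≡J)
  = refl
... | no a≢s  | _      | _
  rewrite χ-edge-no {a = a} {s} {w} {t , i} (a≢s ∘ proj₁) | χ-edge-no {a = a} {s} {w} {t , j} (a≢s ∘ proj₁)
  = refl

shift-target : ∀ {d n} (γ : Fin d → Vtx d n → ℕ) (s t : Fin d) {i j : Fin (n t)} → i ≢ j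
             → shift γ s t i j s (t , j) ≡ + (γ s (t , j) + 1)
shift-target γ s t {i} {j} i≢j = trans (sym (ℤ.+-identityʳ _))
  (subst₂ (λ a b → shift γ s t i j s (t , j) +ℤ + a ≡ + γ s (t , j) +ℤ + b)
    (χ-edge-no {a = s} {s} {t , j} {t , i} (λ (_ , J≡I) → label-≢ i≢j (sym J≡I)))
    (χ-edge-yes {a = s} {s} {t , j} {t , j} refl refl)
    (shift-moves γ s t i≢j s (t , j)))

-- Regrafting a child of I under J

module Regraft {d : ℕ} {n : Fin d → ℕ} (ρ s : Fin d) {t : Fin d} (i j : Fin (n t)) where

  private
    V : Set
    V = Vtx d n
    P : Set
    P = Par d n

  I J : V
  I = t , i
  J = t , j

  regraft : (x : P × V) → Dec (Path (proj₁ x) J (proj₂ x)) → P × V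
  regraft (p , u) (yes _) = swap (p [ u ≔ just J ]) I J , transpose I J u
  regraft (p , u) (no _)  = p [ u ≔ just J ] , u

  regraft-child : ∀ {β} x → ChildPair ρ s β I x → P × V
  regraft-child (p , u) ((tree , _) , _) = regraft (p , u) (Path? (proj₂ (IsRootedTree⁻ tree) J) u)

  regraft-cong : ∀ {p q u} → p ≗ q → (dp : Dec (Path p J u)) (dq : Dec (Path q J u))
               → regraft (p , u) dp ≈ₘ regraft (q , u) dq
  regraft-cong {u = u} p≗q (yes _)    (yes _)    = swap-cong (update-cong _≟V_ p≗q u refl) I J , refl
  regraft-cong         p≗q (yes path) (no ¬path) = ⊥-elim (¬path (Path-cong p≗q path))
  regraft-cong         p≗q (no ¬path) (yes path) = ⊥-elim (¬path (Path-cong (sym ∘ p≗q) path))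
  regraft-cong {u = u} p≗q (no _)     (no _)     = update-cong _≟V_ p≗q u refl , refl

  regraft-child-cong : ∀ {β} x y (cx : ChildPair ρ s β I x) (cy : ChildPair ρ s β I y)
                     → x ≈ₘ y → regraft-child x cx ≈ₘ regraft-child y cy
  regraft-child-cong (p , u) (q , .u) ((tp , _) , _) ((tq , _) , _) (p≗q , refl) =
    regraft-cong p≗q (Path? (proj₂ (IsRootedTree⁻ tp) J) u) (Path? (proj₂ (IsRootedTree⁻ tq) J) u)

  module Regrafted (i≢j : i ≢ j) {p : P} {u : V} (reach : ∀ v → ReachesRoot p v) (pu : p u ≡ just I) where

    I≢J : I ≢ J
    I≢J = label-≢ i≢j

    q : P
    q = p [ u ≔ just J ]

    u≢I : u ≢ I
    u≢I refl = no-cycle (reach u) pu ε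

    q-u : q u ≡ just J
    q-u = update-same _≟V_ p u (just J)

    q-other : ∀ {v} → v ≢ u → q v ≡ p v
    q-other = update-other _≟V_ p (just J)

    q-moves : proj₁ u ≡ s → ChildMove s I J p q
    q-moves tu a w =
      subst (λ t′ → ch q a w + χ (edge? a w t′ (just I)) ≡ ch p a w + χ (edge? a w t′ (just J))) tu
        (subst (λ m → ch q a w + χ (edge? a w (proj₁ u) m) ≡ ch p a w + χ (edge? a w (proj₁ u) (just J))) pu
          (ch-update p u (just J) a w))

    module Reattach (¬path : ¬ Path p J u) where

      reach-J : ReachesRoot q J
      reach-J = ReachesRoot-transfer (reach J) (λ Jw → q-other λ { refl → ¬path Jw })

      reach′ : ∀ v → ReachesRoot q v
      reach′ v = ReachesRoot-patch patch (reach v)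
        where
        patch : ∀ v → ReachesRoot q v ⊎ q v ≡ p v
        patch v = vertex-cases v u (λ { refl → inj₁ (via q-u reach-J) }) (inj₂ ∘ q-other)

      root′ : HasRoot ρ p → HasRoot ρ q
      root′ = HasRoot-transport id (λ _ → refl) (λ _ → refl) to from
        where
        to : ∀ v → q v ≡ nothing → p v ≡ nothing
        to v e = vertex-cases v u (λ { refl → ⊥-elim (nothing≢just (trans (sym e) q-u)) })
                                  (λ v≢u → trans (sym (q-other v≢u)) e)
        from : ∀ v → p v ≡ nothing → q v ≡ nothing
        from v e = vertex-cases v u (λ { refl → ⊥-elim (nothing≢just (trans (sym e) pu)) })
                                    (λ v≢u → trans (q-other v≢u) e)

    module ReattachSwap (path : Path p J u) where

      p′ : P
      p′ = swap q I J

      p′-I : p′ I ≡ q J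
      p′-I = swap-left q I≢J

      p′-J : p′ J ≡ p I
      p′-J = trans (swap-right q I J) (q-other (u≢I ∘ sym))

      p′-other : ∀ {v} → v ≢ u → v ≢ I → v ≢ J → p′ v ≡ p v
      p′-other v≢u v≢I v≢J = trans (swap-other q v≢I v≢J) (q-other v≢u)

      J-step : u ≢ J → ∃[ y ] Parent p J y × Path p y u
      J-step u≢J = step path
        where
        step : Path p J u → ∃[ y ] Parent p J y × Path p y u
        step ε          = ⊥-elim (u≢J refl)
        step (e ◅ rest) = _ , e , rest

      -- The parent of I lies outside the subtree of I, which contains u and J.
      above-I : ∀ {x w} → p I ≡ just x → Path p x w → Path p w I → ⊥
      above-I e xw wI = no-cycle (reach I) e (xw ◅◅ wI)

      reach-J : ReachesRoot p′ J
      reach-J = from-parent-of-I (p I) refl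
        where
        from-parent-of-I : ∀ m → p I ≡ m → ReachesRoot p′ J
        from-parent-of-I nothing  pI = at-root (trans p′-J pI)
        from-parent-of-I (just x) pI = via (trans p′-J pI) (ReachesRoot-transfer (reach x) agree)
          where
          agree : ∀ {w} → Path p x w → p′ w ≡ p w
          agree xw = p′-other (λ { refl → above-I pI xw (pu ◅ ε) }) (λ { refl → above-I pI xw ε })
                              (λ { refl → above-I pI xw (path ◅◅ (pu ◅ ε)) })

      p′-u : u ≢ J → p′ u ≡ just J
      p′-u u≢J = trans (swap-other q u≢I u≢J) q-u

      reach-u : ReachesRoot p′ u
      reach-u = vertex-cases u J (λ { refl → reach-J }) (λ u≢J → via (p′-u u≢J) reach-J)

      below : ∀ {w} → Path p w u → ReachesRoot p′ w
      below ε = reach-u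
      below {w} (e ◅ rest) with w ≟V J | w ≟V u | w ≟V I
      ... | yes refl | _        | _        = reach-J
      ... | no _     | yes refl | _        = reach-u
      ... | no _     | no _     | yes refl = ⊥-elim (no-cycle (reach u) pu (e ◅ rest))
      ... | no w≢J   | no w≢u   | no w≢I   = via (trans (p′-other w≢u w≢I w≢J) e) (below rest)

      reach-I : ReachesRoot p′ I
      reach-I = vertex-cases u J (λ { refl → via (trans p′-I q-u) reach-J }) λ u≢J →
        let (_ , e , rest) = J-step u≢J in via (trans p′-I (trans (q-other (u≢J ∘ sym)) e)) (below rest)

      reach′ : ∀ v → ReachesRoot p′ v
      reach′ v = ReachesRoot-patch patch (reach v)
        where
        patch : ∀ v → ReachesRoot p′ v ⊎ p′ v ≡ p v
        patch v = vertex-cases v I (λ { refl → inj₁ reach-I }) λ v≢I →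
                  vertex-cases v J (λ { refl → inj₁ reach-J }) λ v≢J →
                  vertex-cases v u (λ { refl → inj₁ reach-u }) λ v≢u →
                  inj₂ (p′-other v≢u v≢I v≢J)

      p-J-just : ∃[ y ] p J ≡ just y
      p-J-just = vertex-cases u J (λ { refl → I , pu }) (λ u≢J → let (y , e , _) = J-step u≢J in y , e)

      p′-I-just : ∃[ y ] p′ I ≡ just y
      p′-I-just = vertex-cases u J (λ { refl → J , trans p′-I q-u })
                    (λ u≢J → let (y , e) = p-J-just in y , trans p′-I (trans (q-other (u≢J ∘ sym)) e))

      -- The new root is the old one, or J if I was the root.
      root′ : HasRoot ρ p → HasRoot ρ p′
      root′ = HasRoot-transport (transpose I J) (transpose-type refl) (transpose-involutive I J) to from
        where
        to : ∀ v → p′ v ≡ nothing → p (transpose I J v) ≡ nothing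
        to v e =
          vertex-cases v I (λ { refl → ⊥-elim (nothing≢just (trans (sym e) (proj₂ p′-I-just))) }) λ v≢I →
          vertex-cases v J (λ { refl → trans (cong p (transpose-right I≢J)) (trans (sym p′-J) e) }) λ v≢J →
          vertex-cases v u (λ { refl → ⊥-elim (nothing≢just (trans (sym e) (p′-u v≢J))) }) λ v≢u →
          trans (cong p (transpose-other v≢I v≢J)) (trans (sym (p′-other v≢u v≢I v≢J)) e)
        from : ∀ v → p v ≡ nothing → p′ (transpose I J v) ≡ nothing
        from v e =
          vertex-cases v I (λ { refl → trans (cong p′ (transpose-left I J)) (trans p′-J e) }) λ v≢I →
          vertex-cases v J (λ { refl → ⊥-elim (nothing≢just (trans (sym e) (proj₂ p-J-just))) }) λ v≢J →
          vertex-cases v u (λ { refl → ⊥-elim (nothing≢just (trans (sym e) pu)) }) λ v≢u →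
          trans (cong p′ (transpose-other v≢I v≢J)) (trans (p′-other v≢u v≢I v≢J) e)

      moves : proj₁ u ≡ s → ChildMove s I J p p′
      moves tu a w = trans (cong (_+ χ (edge? a w s (just I))) (ch-swap q refl I≢J a w)) (q-moves tu a w)

      out-type : proj₁ u ≡ s → proj₁ (transpose I J u) ≡ s
      out-type tu = trans (transpose-type refl u) tu

      out-parent : p′ (transpose I J u) ≡ just J
      out-parent = vertex-cases u J (λ { refl → trans (cong p′ (transpose-right I≢J)) (trans p′-I q-u) })
                     (λ u≢J → trans (cong p′ (transpose-other u≢I u≢J)) (p′-u u≢J))

  regraft-sat : ∀ {β β′ p u} → i ≢ j → Moves s I J β β′ → ChildPair ρ s β I (p , u)
              → (dec : Dec (Path p J u)) → ChildPair ρ s β′ J (regraft (p , u) dec)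
  regraft-sat i≢j Mv ((tree , counts) , tu , pu) (yes path) =
    (IsRootedTree⁺ (root′ (proj₁ (IsRootedTree⁻ tree))) reach′ , ch-moves {s = s} {I} {J} (moves tu) Mv counts)
    , out-type tu , out-parent
    where open Regrafted.ReattachSwap i≢j (proj₂ (IsRootedTree⁻ tree)) pu path
  regraft-sat i≢j Mv ((tree , counts) , tu , pu) (no ¬path) =
    (IsRootedTree⁺ (root′ (proj₁ (IsRootedTree⁻ tree))) reach′ , ch-moves {s = s} {I} {J} (q-moves tu) Mv counts)
    , tu , q-u
    where open Regrafted i≢j (proj₂ (IsRootedTree⁻ tree)) pu
          open Reattach ¬path

  regraft-child-sat : ∀ {β β′} → i ≢ j → Moves s I J β β′
                    → ∀ x (c : ChildPair ρ s β I x) → ChildPair ρ s β′ J (regraft-child x c)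
  regraft-child-sat i≢j Mv (p , u) c@((tree , _) , _) = regraft-sat i≢j Mv c (Path? (proj₂ (IsRootedTree⁻ tree) J) u)

module RegraftInverse {d : ℕ} {n : Fin d → ℕ} (ρ s : Fin d) {t : Fin d} {i j : Fin (n t)} (i≢j : i ≢ j) where

  open Regraft {n = n} ρ s i j
  private
    module R′ = Regraft {n = n} ρ s j i

  module _ {p u} (reach : ∀ v → ReachesRoot p v) (pu : p u ≡ just I) (path : Path p J u) where

    open Regrafted i≢j reach pu
    open Regrafted.ReattachSwap i≢j reach pu path

    path-I-to-out : Path p′ I (transpose I J u)
    path-I-to-out = vertex-cases u J (λ { refl → subst (Path p′ I) (sym (transpose-right I≢J)) ε }) λ u≢J →
      let (_ , e , rest) = J-step u≢J in
      subst (Path p′ I) (sym (transpose-other u≢I u≢J))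
        (trans p′-I (trans (q-other (u≢J ∘ sym)) e) ◅ Path-transfer rest (agree e))
      where
      agree : ∀ {y} → Parent p J y → ∀ {v} → Path p y v → Path p v u → v ≢ u → p′ v ≡ p v
      agree e yv vu v≢u = p′-other v≢u (λ { refl → no-cycle (reach u) pu vu }) (λ { refl → no-cycle (reach J) e yv })

    transpose-back : transpose J I (transpose I J u) ≡ u
    transpose-back = vertex-cases u J
      (λ { refl → trans (cong (transpose J I) (transpose-right I≢J)) (transpose-right (I≢J ∘ sym)) })
      (λ u≢J → trans (cong (transpose J I) (transpose-other u≢I u≢J)) (transpose-other u≢J u≢I))

    undo : swap (p′ [ transpose I J u ≔ just I ]) J I ≗ p
    undo = vertex-cases u J
      (λ u≡J → subst (λ x → swap (p′ [ x ≔ just I ]) J I ≗ p)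
                 (sym (trans (cong (transpose I J) u≡J) (transpose-right I≢J))) (undo-I u≡J))
      (λ u≢J → subst (λ x → swap (p′ [ x ≔ just I ]) J I ≗ p) (sym (transpose-other u≢I u≢J)) (undo-u u≢J))
      where
      J≢I : J ≢ I
      J≢I = I≢J ∘ sym

      undo-I : u ≡ J → swap (p′ [ I ≔ just I ]) J I ≗ p
      undo-I u≡J v =
        vertex-cases v J (λ { refl → trans (swap-left r J≢I)
                                       (trans (update-same _≟V_ p′ I (just I)) (sym pJ)) }) λ v≢J →
        vertex-cases v I (λ { refl → trans (swap-right r J I)
                                       (trans (update-other _≟V_ p′ (just I) J≢I) p′-J) }) λ v≢I →
        trans (swap-other r v≢J v≢I)
          (trans (update-other _≟V_ p′ (just I) v≢I) (p′-other (λ v≡u → v≢J (trans v≡u u≡J)) v≢I v≢J))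
        where
        r : Par d n
        r = p′ [ I ≔ just I ]
        pJ : p J ≡ just I
        pJ = subst (λ x → p x ≡ just I) u≡J pu

      undo-u : u ≢ J → swap (p′ [ u ≔ just I ]) J I ≗ p
      undo-u u≢J v =
        vertex-cases v J (λ { refl → trans (swap-left r J≢I)
                                       (trans (update-other _≟V_ p′ (just I) (u≢I ∘ sym)) p′-I′) }) λ v≢J →
        vertex-cases v I (λ { refl → trans (swap-right r J I)
                                       (trans (update-other _≟V_ p′ (just I) (u≢J ∘ sym)) p′-J) }) λ v≢I →
        vertex-cases v u (λ { refl → trans (swap-other r v≢J v≢I)
                                       (trans (update-same _≟V_ p′ u (just I)) (sym pu)) }) λ v≢u →
        trans (swap-other r v≢J v≢I) (trans (update-other _≟V_ p′ (just I) v≢u) (p′-other v≢u v≢I v≢J))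
        where
        r : Par d n
        r = p′ [ u ≔ just I ]
        p′-I′ : p′ I ≡ p J
        p′-I′ = trans p′-I (q-other (u≢J ∘ sym))

  regraft-inverse : ∀ {p u} (reach : ∀ v → ReachesRoot p v) (pu : p u ≡ just I) (dec : Dec (Path p J u))
                    (dec′ : Dec (Path (proj₁ (regraft (p , u) dec)) I (proj₂ (regraft (p , u) dec))))
                  → R′.regraft (regraft (p , u) dec) dec′ ≈ₘ (p , u)
  regraft-inverse reach pu (yes path) (yes _)      = undo reach pu path , transpose-back reach pu path
  regraft-inverse reach pu (yes path) (no ¬path′)  = ⊥-elim (¬path′ (path-I-to-out reach pu path))
  regraft-inverse reach pu (no ¬path) (yes path′)  =
    ⊥-elim ([ no-cycle (reach _) pu , no-cycle (reach _) pu ]′ (Path-update⁻ (Regrafted.q-other i≢j reach pu) path′))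
  regraft-inverse {p} {u} reach pu (no _) (no _)   =
    (λ v → trans (update-overwrite _≟V_ p u (just J) (just I) v) (update-self _≟V_ p pu v)) , refl

  regraft-child-inverse : ∀ {β β′} x (c : ChildPair ρ s β I x) (c′ : ChildPair ρ s β′ J (regraft-child x c))
                        → R′.regraft-child (regraft-child x c) c′ ≈ₘ x
  regraft-child-inverse (p , u) ((tree , _) , _ , pu) ((tree′ , _) , _) =
    regraft-inverse reach pu (Path? (reach J) u) (Path? (proj₂ (IsRootedTree⁻ tree′) I) _)
    where
    reach : ∀ v → ReachesRoot p v
    reach = proj₂ (IsRootedTree⁻ tree)

child-pairs-equinumerous : ∀ {d n} (ρ : Fin d) (γ : Fin d → Vtx d n → ℕ) (s t : Fin d) {i j : Fin (n t)} → i ≢ j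
  → ∀ {m m′} → CardT d n ρ (λ a v → + γ a v) m → CardT d n ρ (shift γ s t i j) m′
  → m * γ s (t , i) ≡ m′ * (γ s (t , j) + 1)
child-pairs-equinumerous {n = n} ρ γ s t {i} {j} i≢j card card′ = count-≡ marked-distinct marked-complete
  (count-ChildPair (t , i) (λ (_ , counts) → ℤ.+-injective (counts s (t , i))) card)
  (count-ChildPair (t , j) (λ (_ , counts) → ℤ.+-injective (trans (counts s (t , j)) (shift-target γ s t i≢j))) card′)
  ChildPair-cong ChildPair-cong
  I→J.regraft-child (I→J.regraft-child-sat i≢j moves) J→I.regraft-child (J→I.regraft-child-sat (i≢j ∘ sym) moves⁻)
  I→J.regraft-child-cong J→I.regraft-child-cong
  (λ x c → I→J→I.regraft-child-inverse x c (I→J.regraft-child-sat i≢j moves x c))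
  (λ x c → J→I→J.regraft-child-inverse x c (J→I.regraft-child-sat (i≢j ∘ sym) moves⁻ x c))
  where
  open Counting marked-setoid using (count-≡)
  module I→J = Regraft {n = n} ρ s i j
  module J→I = Regraft {n = n} ρ s j i
  module I→J→I = RegraftInverse {n = n} ρ s i≢j
  module J→I→J = RegraftInverse {n = n} ρ s (i≢j ∘ sym)
  moves : Moves s (t , i) (t , j) (λ a v → + γ a v) (shift γ s t i j)
  moves = shift-moves γ s t i≢j
  moves⁻ : Moves s (t , j) (t , i) (shift γ s t i j) (λ a v → + γ a v)
  moves⁻ a w = sym (moves a w)

lemma2p3 : (d : ℕ) (n : Fin d → ℕ) → (∀ t → 1 ≤ n t) → (ρ : Fin d)
    → (γ : Fin d → Vtx d n → ℕ) → (s t : Fin d) → (i j : Fin (n t)) → i ≢ j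
    → (m m′ : ℕ)
    → CardT d n ρ (λ a v → + γ a v) m
    → CardT d n ρ (shift γ s t i j) m′
    → + (γ s (t , i) * m) ≡ shift γ s t i j s (t , j) *ℤ + m′
lemma2p3 d n _ ρ γ s t i j i≢j m m′ card card′ = begin
  + (γ s I * m)                    ≡⟨ cong +_ (ℕ.*-comm (γ s I) m) ⟩
  + (m * γ s I)                    ≡⟨ cong +_ (child-pairs-equinumerous ρ γ s t i≢j card card′) ⟩
  + (m′ * (γ s J + 1))             ≡⟨ cong +_ (ℕ.*-comm m′ (γ s J + 1)) ⟩
  + ((γ s J + 1) * m′)             ≡⟨ ℤ.pos-* (γ s J + 1) m′ ⟩
  + (γ s J + 1) *ℤ + m′            ≡⟨ cong (_*ℤ + m′) (shift-target γ s t i≢j) ⟨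
  shift γ s t i j s J *ℤ + m′      ∎
  where
  open ≡-Reasoning
  I J : Vtx d n
  I = t , i
  J = t , j
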